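{- Let $\alpha,\beta$ be coprime nonzero integers with $|\alpha|\ne|\beta|$, and let $\{u_n\}_{n\ge0}$ be a sequence of integers satisfying $u_{n+3}=r_1u_{n+2}+r_2u_{n+1}+r_3u_n$, where $r_1,r_2,r_3$ are integers and $X^3-r_1X^2-r_2X-r_3=(X-\alpha)^2(X-\beta)$, so that $u_n=p(n)\alpha^n+b\beta^n$ with $p(X)=aX+c\in\mathbb{Q}[X]$, $a\ne0$, $b\in\mathbb{Q}$. Put $Y=\max\{|r_1|,|r_2|,|r_3|,|u_0|,|u_1|,|u_2|\}$. If $n\ge0$ is an integer with $u_n=0$, then $n<39Y\log Y$. -}

module Defs where

open import Data.Nat as ℕ using (ℕ; suc; _<_)
open import Data.Integer as ℤ using (ℤ)
open import Data.Rational as ℚ using (ℚ)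
open import Data.Product using (Σ; _×_)

toℚ : ℤ → ℚ
toℚ z = z ℚ./ 1

-- ExpLt n M  means  e^n < M  (e = Euler's number), for n, M natural.
-- Characterisation used: the rational sequence ((m+1)/m)^(n(m+1)), m ≥ 1,
-- decreases strictly to e^n (strictly from above when n ≥ 1, constantly 1
-- when n = 0), hence  e^n < M  iff  some term of it is < M.
-- Cleared of denominators:  (m+1)^(n(m+1)) < M * m^(n(m+1)).
ExpLt : ℕ → ℕ → Set
ExpLt n M = Σ ℕ λ k →
  let m = suc k in
  (suc m) ℕ.^ (n ℕ.* suc m) < M ℕ.* (m ℕ.^ (n ℕ.* suc m))

-- n < 39 Y log Y   (natural log, Y ≥ 1)
--   iff  e^n < Y^(39Y)   (exp is strictly increasing)
LtThirtyNineYLogY : ℕ → ℕ → Set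
LtThirtyNineYLogY n Y = ExpLt n (Y ℕ.^ (39 ℕ.* Y))

{-# OPTIONS --safe #-}

-- Solving the recurrence over ℤ gives α (α - β)² uₙ = (P n + Q) αⁿ + α B βⁿ with integers
-- P, Q, α B of absolute value at most Y⁷.  If uₙ = 0 then |P n + Q| |α|ⁿ = |α B| |β|ⁿ, and as
-- |α|, |β| are coprime and one of them is at least 2, either both sides vanish or
-- 2ⁿ ≤ |P n + Q| + |α B| ≤ Y⁷ (n + 2), whence 4ⁿ ≤ Y³⁴.  If both sides vanish, then B = 0 and
-- n is the root of P n + Q = (α - β)² (k n + α u₀) with k = u₁ - α u₀ ≠ 0 (this is where a ≠ 0
-- enters), so n = 1 - u₁ / k ≤ 1 + Y.  In both cases eⁿ < 4ⁿ ≤ Y^(39 Y).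
module Submission where

open import Defs
open import Data.Nat as ℕ using (ℕ; _⊔_)
open import Data.Nat.Coprimality using (Coprime)
open import Data.Integer as ℤ using (ℤ; ∣_∣; _+_; _*_; -_; _^_)
open import Data.Rational as ℚ using (ℚ)
open import Relation.Binary.PropositionalEquality using (_≡_; _≢_)

open import Data.Nat using (zero; suc; _≤_; _<_; z≤n; s≤s; NonZero)
open import Data.Nat.Properties
open import Data.Nat.Divisibility using (_∣_; divides; ∣-trans; ∣⇒≤)
import Data.Nat.Coprimality as Coprime
import Data.Nat.Tactic.RingSolver as ℕ-Solver
open import Data.Integer using (0ℤ; 1ℤ; _-_)
import Data.Integer.Properties as ℤP
open import Data.Integer.Tactic.RingSolver using (solve-∀; solve)
open import Algebra.Properties.AbelianGroup ℤP.+-0-abelianGroup using (inverseˡ-unique)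
open import Data.Rational using (0ℚ; 1ℚ)
import Data.Rational.Properties as ℚP
import Data.Rational.Unnormalised as ℚᵘ
import Data.Rational.Unnormalised.Properties as ℚᵘP
open import Data.Rational.Solver renaming (module +-*-Solver to ℚ-Solver)
open import Data.List using (_∷_; [])
open import Data.Product using (_×_; _,_; proj₁; proj₂)
open import Data.Sum as Sum using (_⊎_; inj₁; inj₂; [_,_]′)
open import Relation.Nullary using (yes; no)
open import Data.Empty using (⊥-elim)
open import Function using (_∘_; id)
open import Relation.Binary.PropositionalEquality
  using (refl; sym; trans; cong; cong₂; subst; module ≡-Reasoning)

record Recurrence (r₁ r₂ r₃ : ℤ) (u : ℕ → ℤ) : Set where
  constructor recurrence
  field
    step : ∀ n → u (suc (suc (suc n))) ≡ r₁ * u (suc (suc n)) + r₂ * u (suc n) + r₃ * u n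

module _ {r₁ r₂ r₃ : ℤ} where

  recurrence-unique : ∀ {u v} → Recurrence r₁ r₂ r₃ u → Recurrence r₁ r₂ r₃ v →
                      u 0 ≡ v 0 → u 1 ≡ v 1 → u 2 ≡ v 2 → ∀ n → u n ≡ v n
  recurrence-unique {u} {v} (recurrence rec-u) (recurrence rec-v) e₀ e₁ e₂ n = proj₁ (agree n)
    where
    agree : ∀ n → u n ≡ v n × u (suc n) ≡ v (suc n) × u (suc (suc n)) ≡ v (suc (suc n))
    agree zero    = e₀ , e₁ , e₂
    agree (suc n) with agree n
    ... | eₙ , eₙ₊₁ , eₙ₊₂ = eₙ₊₁ , eₙ₊₂ , (begin
      u (3 ℕ.+ n)                                   ≡⟨ rec-u n ⟩
      r₁ * u (2 ℕ.+ n) + r₂ * u (1 ℕ.+ n) + r₃ * u n ≡⟨ cong₂ _+_ (cong₂ _+_ (cong (r₁ *_) eₙ₊₂)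
                                                                          (cong (r₂ *_) eₙ₊₁))
                                                                (cong (r₃ *_) eₙ) ⟩
      r₁ * v (2 ℕ.+ n) + r₂ * v (1 ℕ.+ n) + r₃ * v n ≡⟨ rec-v n ⟨
      v (3 ℕ.+ n)                                   ∎)
      where open ≡-Reasoning

  recurrence-scale : ∀ k {u} → Recurrence r₁ r₂ r₃ u → Recurrence r₁ r₂ r₃ (λ n → k * u n)
  recurrence-scale k (recurrence rec) = recurrence λ n →
    trans (cong (k *_) (rec n)) (distrib k r₁ r₂ r₃ _ _ _)
    where
    distrib : ∀ k r₁ r₂ r₃ x₂ x₁ x₀ →
              k * (r₁ * x₂ + r₂ * x₁ + r₃ * x₀) ≡ r₁ * (k * x₂) + r₂ * (k * x₁) + r₃ * (k * x₀)
    distrib = solve-∀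

  recurrence-+ : ∀ {u v} → Recurrence r₁ r₂ r₃ u → Recurrence r₁ r₂ r₃ v →
                 Recurrence r₁ r₂ r₃ (λ n → u n + v n)
  recurrence-+ (recurrence rec-u) (recurrence rec-v) = recurrence λ n →
    trans (cong₂ _+_ (rec-u n) (rec-v n)) (regroup r₁ r₂ r₃ _ _ _ _ _ _)
    where
    regroup : ∀ r₁ r₂ r₃ x₂ x₁ x₀ y₂ y₁ y₀ →
              (r₁ * x₂ + r₂ * x₁ + r₃ * x₀) + (r₁ * y₂ + r₂ * y₁ + r₃ * y₀)
              ≡ r₁ * (x₂ + y₂) + r₂ * (x₁ + y₁) + r₃ * (x₀ + y₀)
    regroup = solve-∀

-- Characteristic polynomial (X - α)² (X - β).
DoubleRootRecurrence : ℤ → ℤ → (ℕ → ℤ) → Set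
DoubleRootRecurrence α β = Recurrence (α + α + β) (- (α * α + α * β + α * β)) (α * α * β)

doubleRoot-solution : ∀ α β p q → DoubleRootRecurrence α β (λ n → (p * ℤ.+ n + q) * α ^ n)
doubleRoot-solution α β p q = recurrence λ n → identity α β p q (ℤ.+ n) (α ^ n)
  where
  -- Stated with 1ℤ + t because 1ℤ + ℤ.+ n computes to ℤ.+ suc n.
  identity : ∀ α β p q t x →
    (p * (1ℤ + (1ℤ + (1ℤ + t))) + q) * (α * (α * (α * x)))
    ≡ (α + α + β) * ((p * (1ℤ + (1ℤ + t)) + q) * (α * (α * x)))
      + - (α * α + α * β + α * β) * ((p * (1ℤ + t) + q) * (α * x))
      + α * α * β * ((p * t + q) * x)
  identity = solve-∀

simpleRoot-solution : ∀ α β e → DoubleRootRecurrence α β (λ n → e * β ^ n)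
simpleRoot-solution α β e = recurrence λ n → identity α β e (β ^ n)
  where
  identity : ∀ α β e y →
    e * (β * (β * (β * y)))
    ≡ (α + α + β) * (e * (β * (β * y))) + - (α * α + α * β + α * β) * (e * (β * y))
      + α * α * β * (e * y)
  identity = solve-∀

closedForm : (α β p q e : ℤ) → ℕ → ℤ
closedForm α β p q e n = (p * ℤ.+ n + q) * α ^ n + e * β ^ n

closedForm-recurrence : ∀ α β p q e → DoubleRootRecurrence α β (closedForm α β p q e)
closedForm-recurrence α β p q e =
  recurrence-+ (doubleRoot-solution α β p q) (simpleRoot-solution α β e)

k*n≡k-m⇒n≤1+∣m∣ : ∀ {k m n} → k ≢ 0ℤ → k * ℤ.+ n ≡ k - m → n ≤ suc ∣ m ∣
k*n≡k-m⇒n≤1+∣m∣ {k} {m} {n} k≢0 k*n≡k-m = *-cancelˡ-≤ ∣ k ∣ (begin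
  ∣ k ∣ ℕ.* n              ≡⟨ ℤP.abs-* k (ℤ.+ n) ⟨
  ∣ k * ℤ.+ n ∣            ≡⟨ cong ∣_∣ k*n≡k-m ⟩
  ∣ k - m ∣                ≤⟨ ℤP.∣i-j∣≤∣i∣+∣j∣ k m ⟩
  ∣ k ∣ ℕ.+ ∣ m ∣          ≤⟨ +-monoʳ-≤ ∣ k ∣ (m≤n*m ∣ m ∣ ∣ k ∣) ⟩
  ∣ k ∣ ℕ.+ ∣ k ∣ ℕ.* ∣ m ∣ ≡⟨ *-suc ∣ k ∣ ∣ m ∣ ⟨
  ∣ k ∣ ℕ.* suc ∣ m ∣      ∎)
  where
  open ≤-Reasoning
  instance
    ∣k∣≢0 : NonZero ∣ k ∣
    ∣k∣≢0 = ℕ.≢-nonZero (k≢0 ∘ ℤP.∣i∣≡0⇒i≡0)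

toℚᵘ-toℚ : ∀ z → ℚ.toℚᵘ (toℚ z) ℚᵘ.≃ ℚᵘ.mkℚᵘ z 0
toℚᵘ-toℚ z = ℚP.toℚᵘ-fromℚᵘ (ℚᵘ.mkℚᵘ z 0)

toℚ-≃ : ∀ z {p} → ℚᵘ.mkℚᵘ z 0 ℚᵘ.≃ ℚ.toℚᵘ p → toℚ z ≡ p
toℚ-≃ z z≃p = ℚP.toℚᵘ-injective (ℚᵘP.≃-trans (toℚᵘ-toℚ z) z≃p)

toℚ-injective : ∀ {x y} → toℚ x ≡ toℚ y → x ≡ y
toℚ-injective {x} {y} eq
  with ℚᵘP.≃-trans (ℚᵘP.≃-sym (toℚᵘ-toℚ x))
                   (ℚᵘP.≃-trans (ℚᵘP.≃-reflexive (cong ℚ.toℚᵘ eq)) (toℚᵘ-toℚ y))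
... | ℚᵘ.*≡* x*1≡y*1 = ℤP.*-cancelʳ-≡ x y 1ℤ x*1≡y*1

toℚ-homo-+ : ∀ x y → toℚ (x + y) ≡ toℚ x ℚ.+ toℚ y
toℚ-homo-+ x y = toℚ-≃ (x + y) (ℚᵘP.≃-trans (ℚᵘ.*≡* (identity x y))
  (ℚᵘP.≃-sym (ℚᵘP.≃-trans (ℚP.toℚᵘ-homo-+ (toℚ x) (toℚ y)) (ℚᵘP.+-cong (toℚᵘ-toℚ x) (toℚᵘ-toℚ y)))))
  where
  identity : ∀ x y → (x + y) * 1ℤ ≡ (x * 1ℤ + y * 1ℤ) * 1ℤ
  identity = solve-∀

toℚ-homo-* : ∀ x y → toℚ (x * y) ≡ toℚ x ℚ.* toℚ y
toℚ-homo-* x y = toℚ-≃ (x * y) (ℚᵘP.≃-trans (ℚᵘ.*≡* refl)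
  (ℚᵘP.≃-sym (ℚᵘP.≃-trans (ℚP.toℚᵘ-homo-* (toℚ x) (toℚ y)) (ℚᵘP.*-cong (toℚᵘ-toℚ x) (toℚᵘ-toℚ y)))))

toℚ-homo‿- : ∀ x → toℚ (- x) ≡ ℚ.- toℚ x
toℚ-homo‿- x = toℚ-≃ (- x) (ℚᵘP.≃-trans (ℚᵘ.*≡* refl)
  (ℚᵘP.≃-sym (ℚᵘP.≃-trans (ℚP.toℚᵘ-homo‿- (toℚ x)) (ℚᵘP.-‿cong (toℚᵘ-toℚ x)))))

p*q≡0⇒p≡0∨q≡0 : ∀ p q → p ℚ.* q ≡ 0ℚ → p ≡ 0ℚ ⊎ q ≡ 0ℚ
p*q≡0⇒p≡0∨q≡0 p@record{} q@record{} p*q≡0 =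
  Sum.map (ℚP.↥p≡0⇒p≡0 p) (ℚP.↥p≡0⇒p≡0 q) (ℤP.i*j≡0⇒i≡0∨j≡0 (ℚ.↥ p) ↥p*↥q≡0)
  where
  ↥p*↥q≡0 : ℚ.↥ p * ℚ.↥ q ≡ 0ℤ
  ↥p*↥q≡0 = ℚᵘP.p≃0⇒↥p≡0 _
    (ℚᵘP.≃-trans (ℚᵘP.≃-sym (ℚP.toℚᵘ-homo-* p q)) (ℚᵘP.≃-reflexive (cong ℚ.toℚᵘ p*q≡0)))

toℚ-homo-minus : ∀ x y → toℚ (x - y) ≡ toℚ x ℚ.- toℚ y
toℚ-homo-minus x y = trans (toℚ-homo-+ x (- y)) (cong (toℚ x ℚ.+_) (toℚ-homo‿- y))

toℚ-square : ∀ z → toℚ (z ^ 2) ≡ toℚ z ℚ.* toℚ z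
toℚ-square z = trans (cong (λ s → toℚ (z * s)) (ℤP.^-identityʳ z)) (toℚ-homo-* z z)

-- The value at n = 0 of (E - x)(E - y) applied to (a n + c) xⁿ + b yⁿ, with E the shift.
closedForm-secondDifference : ∀ a b c x y →
  (a ℚ.* (1ℚ ℚ.+ 1ℚ) ℚ.+ c) ℚ.* (x ℚ.* x) ℚ.+ b ℚ.* (y ℚ.* y)
    ℚ.- (x ℚ.+ y) ℚ.* ((a ℚ.* 1ℚ ℚ.+ c) ℚ.* x ℚ.+ b ℚ.* y)
    ℚ.+ x ℚ.* y ℚ.* ((a ℚ.* 0ℚ ℚ.+ c) ℚ.* 1ℚ ℚ.+ b ℚ.* 1ℚ)
  ≡ a ℚ.* ((x ℚ.- y) ℚ.* x)
closedForm-secondDifference = ℚ-Solver.solve 5 (λ a b c x y →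
  (a :* (con 1ℚ :+ con 1ℚ) :+ c) :* (x :* x) :+ b :* (y :* y)
    :- (x :+ y) :* ((a :* con 1ℚ :+ c) :* x :+ b :* y)
    :+ x :* y :* ((a :* con 0ℚ :+ c) :* con 1ℚ :+ b :* con 1ℚ)
  := a :* ((x :- y) :* x)) refl
  where open ℚ-Solver using (_:+_; _:*_; _:-_; con; _:=_)

-- With E the shift, k, A and B are the values at 0 of (E - α) u, (E - α)(E - β) u and
-- (E - α)² u; P, Q and α B are the coordinates of α (α - β)² u in the basis n αⁿ, αⁿ, βⁿ.
module Coefficients (α β : ℤ) (u : ℕ → ℤ) where

  d k A B P Q : ℤ
  d = α - β
  k = u 1 - α * u 0
  A = u 2 - (α + β) * u 1 + α * β * u 0
  B = u 2 - (α + α) * u 1 + α * α * u 0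
  P = d * A
  Q = α * (d * d * u 0 - B)

  scaled-closedForm : DoubleRootRecurrence α β u →
                      ∀ n → α * d * d * u n ≡ closedForm α β P Q (α * B) n
  scaled-closedForm rec =
    let fits₀ , fits₁ , fits₂ = fits α β (u 0) (u 1) (u 2)
    in recurrence-unique (recurrence-scale (α * d * d) rec) (closedForm-recurrence α β P Q (α * B))
                         fits₀ fits₁ fits₂
    where
    fits : ∀ α β u₀ u₁ u₂ →
      let d = α - β
          A = u₂ - (α + β) * u₁ + α * β * u₀
          B = u₂ - (α + α) * u₁ + α * α * u₀
          P = d * A
          Q = α * (d * d * u₀ - B)
      in α * d * d * u₀ ≡ (P * ℤ.+ 0 + Q) * 1ℤ + α * B * 1ℤ
       × α * d * d * u₁ ≡ (P * ℤ.+ 1 + Q) * (α * 1ℤ) + α * B * (β * 1ℤ)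
       × α * d * d * u₂ ≡ (P * ℤ.+ 2 + Q) * (α * (α * 1ℤ)) + α * B * (β * (β * 1ℤ))
    fits α β u₀ u₁ u₂ = solve vars , solve vars , solve vars
      where vars = α ∷ β ∷ u₀ ∷ u₁ ∷ u₂ ∷ []

  P*n+Q≡0⇒n≤1+∣u₁∣ : d ≢ 0ℤ → A ≢ 0ℤ → B ≡ 0ℤ → ∀ n → P * ℤ.+ n + Q ≡ 0ℤ → n ≤ suc ∣ u 1 ∣
  P*n+Q≡0⇒n≤1+∣u₁∣ d≢0 A≢0 B≡0 n N≡0 = k*n≡k-m⇒n≤1+∣m∣ k≢0 k*n≡k-u₁
    where
    open ≡-Reasoning
    identities : ∀ α β u₀ u₁ u₂ t →
      let d = α - β
          k = u₁ - α * u₀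
          A = u₂ - (α + β) * u₁ + α * β * u₀
          B = u₂ - (α + α) * u₁ + α * α * u₀
      in A ≡ d * k + B
       × d * A * t + α * (d * d * u₀ - B) ≡ d * d * (k * t + α * u₀) + B * (d * t - α)
       × k * t ≡ (k * t + α * u₀) + (k - u₁)
    identities α β u₀ u₁ u₂ t = solve vars , solve vars , solve vars
      where vars = α ∷ β ∷ u₀ ∷ u₁ ∷ u₂ ∷ t ∷ []

    w : ℤ
    w = k * ℤ.+ n + α * u 0

    A≡d*k+B : A ≡ d * k + B
    A≡d*k+B = proj₁ (identities α β (u 0) (u 1) (u 2) (ℤ.+ n))

    N≡d*d*w+B*[d*n-α] : P * ℤ.+ n + Q ≡ d * d * w + B * (d * ℤ.+ n - α)
    N≡d*d*w+B*[d*n-α] = proj₁ (proj₂ (identities α β (u 0) (u 1) (u 2) (ℤ.+ n)))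

    k*n≡w+[k-u₁] : k * ℤ.+ n ≡ w + (k - u 1)
    k*n≡w+[k-u₁] = proj₂ (proj₂ (identities α β (u 0) (u 1) (u 2) (ℤ.+ n)))

    d*d*w≡0 : d * d * w ≡ 0ℤ
    d*d*w≡0 = begin
      d * d * w                        ≡⟨ ℤP.+-identityʳ (d * d * w) ⟨
      d * d * w + 0ℤ * (d * ℤ.+ n - α) ≡⟨ cong (λ b → d * d * w + b * (d * ℤ.+ n - α)) B≡0 ⟨
      d * d * w + B * (d * ℤ.+ n - α)  ≡⟨ N≡d*d*w+B*[d*n-α] ⟨
      P * ℤ.+ n + Q                    ≡⟨ N≡0 ⟩
      0ℤ                               ∎

    w≡0 : w ≡ 0ℤ
    w≡0 = [ ⊥-elim ∘ [ d≢0 , d≢0 ]′ ∘ ℤP.i*j≡0⇒i≡0∨j≡0 d , id ]′ (ℤP.i*j≡0⇒i≡0∨j≡0 (d * d) d*d*w≡0)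

    k≢0 : k ≢ 0ℤ
    k≢0 k≡0 = A≢0 (begin
      A          ≡⟨ A≡d*k+B ⟩
      d * k + B  ≡⟨ cong₂ (λ k b → d * k + b) k≡0 B≡0 ⟩
      d * 0ℤ + 0ℤ ≡⟨ cong (_+ 0ℤ) (ℤP.*-zeroʳ d) ⟩
      0ℤ         ∎)

    k*n≡k-u₁ : k * ℤ.+ n ≡ k - u 1
    k*n≡k-u₁ = begin
      k * ℤ.+ n        ≡⟨ k*n≡w+[k-u₁] ⟩
      w + (k - u 1)    ≡⟨ cong (_+ (k - u 1)) w≡0 ⟩
      0ℤ + (k - u 1)   ≡⟨ ℤP.+-identityˡ (k - u 1) ⟩
      k - u 1          ∎

  module _ (a b c : ℚ)
           (closed : ∀ n → toℚ (u n) ≡ (a ℚ.* toℚ (ℤ.+ n) ℚ.+ c) ℚ.* toℚ (α ^ n) ℚ.+ b ℚ.* toℚ (β ^ n))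
           where

    toℚ-A : toℚ A ≡ a ℚ.* toℚ (d * α)
    toℚ-A = begin
      toℚ A
        ≡⟨ toℚ-homo-+ (u 2 - (α + β) * u 1) (α * β * u 0) ⟩
      toℚ (u 2 - (α + β) * u 1) ℚ.+ toℚ (α * β * u 0)
        ≡⟨ cong₂ ℚ._+_ (toℚ-homo-minus (u 2) ((α + β) * u 1)) (toℚ-homo-* (α * β) (u 0)) ⟩
      toℚ (u 2) ℚ.- toℚ ((α + β) * u 1) ℚ.+ toℚ (α * β) ℚ.* toℚ (u 0)
        ≡⟨ cong₂ (λ s t → toℚ (u 2) ℚ.- s ℚ.+ t ℚ.* toℚ (u 0))
                 (trans (toℚ-homo-* (α + β) (u 1)) (cong (ℚ._* toℚ (u 1)) (toℚ-homo-+ α β)))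
                 (toℚ-homo-* α β) ⟩
      Δ (toℚ (u 2)) (toℚ (u 1)) (toℚ (u 0))
        ≡⟨ cong₂ (λ s t → Δ s t (toℚ (u 0))) (trans (closed 2) (cong₂ (f 2) (toℚ-square α) (toℚ-square β)))
                                             (trans (closed 1) (cong₂ (f 1) (toℚ-^1 α) (toℚ-^1 β))) ⟩
      Δ (f 2 (x ℚ.* x) (y ℚ.* y)) (f 1 x y) (toℚ (u 0))
        ≡⟨ cong (Δ (f 2 (x ℚ.* x) (y ℚ.* y)) (f 1 x y)) (closed 0) ⟩
      Δ (f 2 (x ℚ.* x) (y ℚ.* y)) (f 1 x y) (f 0 1ℚ 1ℚ)
        ≡⟨ closedForm-secondDifference a b c x y ⟩
      a ℚ.* ((x ℚ.- y) ℚ.* x)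
        ≡⟨ cong (a ℚ.*_) (trans (toℚ-homo-* d α) (cong (ℚ._* x) (toℚ-homo-minus α β))) ⟨
      a ℚ.* toℚ (d * α)
        ∎
      where
      open ≡-Reasoning
      x y : ℚ
      x = toℚ α
      y = toℚ β

      Δ : ℚ → ℚ → ℚ → ℚ
      Δ s₂ s₁ s₀ = s₂ ℚ.- (x ℚ.+ y) ℚ.* s₁ ℚ.+ x ℚ.* y ℚ.* s₀

      f : ℕ → ℚ → ℚ → ℚ
      f n xⁿ yⁿ = (a ℚ.* toℚ (ℤ.+ n) ℚ.+ c) ℚ.* xⁿ ℚ.+ b ℚ.* yⁿ

      toℚ-^1 : ∀ z → toℚ (z ^ 1) ≡ toℚ z
      toℚ-^1 z = cong toℚ (ℤP.^-identityʳ z)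

    a≢0⇒A≢0 : a ≢ 0ℚ → d * α ≢ 0ℤ → A ≢ 0ℤ
    a≢0⇒A≢0 a≢0 d*α≢0 A≡0 = [ a≢0 , d*α≢0 ∘ toℚ-injective {y = 0ℤ} ]′
      (p*q≡0⇒p≡0∨q≡0 a (toℚ (d * α)) (trans (sym toℚ-A) (cong toℚ A≡0)))

coprime-*ˡ : ∀ {m n o} → Coprime m o → Coprime n o → Coprime (m ℕ.* n) o
coprime-*ˡ {m} {n} {o} m⊥o n⊥o {i} (i∣mn , i∣o) = n⊥o (Coprime.coprime-divisor i⊥m i∣mn , i∣o)
  where
  i⊥m : Coprime i m
  i⊥m (j∣i , j∣m) = m⊥o (j∣m , ∣-trans j∣i i∣o)

coprime-^ˡ : ∀ {m n} i → Coprime m n → Coprime (m ℕ.^ i) n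
coprime-^ˡ {n = n} zero    m⊥n = Coprime.1-coprimeTo n
coprime-^ˡ         (suc i) m⊥n = coprime-*ˡ m⊥n (coprime-^ˡ i m⊥n)

coprime-^ : ∀ {m n} i j → Coprime m n → Coprime (m ℕ.^ i) (n ℕ.^ j)
coprime-^ i j m⊥n = coprime-^ˡ i (Coprime.sym (coprime-^ˡ j (Coprime.sym m⊥n)))

2≤m⊎2≤n : ∀ {m n} → m ≢ 0 → n ≢ 0 → m ≢ n → 2 ≤ m ⊎ 2 ≤ n
2≤m⊎2≤n {0}           m≢0 n≢0 m≢n = ⊥-elim (m≢0 refl)
2≤m⊎2≤n {suc (suc m)} m≢0 n≢0 m≢n = inj₁ (s≤s (s≤s z≤n))
2≤m⊎2≤n {1} {0}           m≢0 n≢0 m≢n = ⊥-elim (n≢0 refl)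
2≤m⊎2≤n {1} {1}           m≢0 n≢0 m≢n = ⊥-elim (m≢n refl)
2≤m⊎2≤n {1} {suc (suc n)} m≢0 n≢0 m≢n = inj₂ (s≤s (s≤s z≤n))

-- Since a and b are coprime, x aⁿ = y bⁿ forces bⁿ ∣ x and aⁿ ∣ y.
balance-bound : ∀ {a b x y} n → a ≢ 0 → b ≢ 0 → Coprime a b → 2 ≤ a ⊎ 2 ≤ b →
                x ℕ.* a ℕ.^ n ≡ y ℕ.* b ℕ.^ n → (x ≡ 0 × y ≡ 0) ⊎ 2 ℕ.^ n ≤ x ℕ.+ y
balance-bound {a} {b} {x} {y} n a≢0 b≢0 a⊥b 2≤a⊎2≤b balance with y ℕ.≟ 0
... | yes refl = inj₁ (m*n≡0⇒m≡0 x (a ℕ.^ n) balance , refl)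
  where instance _ = m^n≢0 a n {{ℕ.≢-nonZero a≢0}}
... | no y≢0   = inj₂ ([ (λ 2≤a → ≤-trans (growth 2≤a y≢0 aⁿ∣y) (m≤n+m y x))
                         , (λ 2≤b → ≤-trans (growth 2≤b x≢0 bⁿ∣x) (m≤m+n x y)) ]′ 2≤a⊎2≤b)
  where
  growth : ∀ {c z} → 2 ≤ c → z ≢ 0 → c ℕ.^ n ∣ z → 2 ℕ.^ n ≤ z
  growth 2≤c z≢0 cⁿ∣z = ≤-trans (^-monoˡ-≤ n 2≤c) (∣⇒≤ {{ℕ.≢-nonZero z≢0}} cⁿ∣z)

  x≢0 : x ≢ 0
  x≢0 refl = y≢0 (m*n≡0⇒m≡0 y (b ℕ.^ n) {{m^n≢0 b n {{ℕ.≢-nonZero b≢0}}}} (sym balance))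

  aⁿ∣y : a ℕ.^ n ∣ y
  aⁿ∣y = Coprime.coprime-divisor (coprime-^ n n a⊥b) (divides x (trans (*-comm _ y) (sym balance)))

  bⁿ∣x : b ℕ.^ n ∣ x
  bⁿ∣x = Coprime.coprime-divisor (coprime-^ n n (Coprime.sym a⊥b)) (divides y (trans (*-comm _ x) balance))

-- From growth bounds to n < 39 Y log Y

8*2ⁿ+8*2ⁿ≡8*2¹⁺ⁿ : ∀ n → 8 ℕ.* 2 ℕ.^ n ℕ.+ 8 ℕ.* 2 ℕ.^ n ≡ 8 ℕ.* 2 ℕ.^ suc n
8*2ⁿ+8*2ⁿ≡8*2¹⁺ⁿ n = double (2 ℕ.^ n)
  where
  double : ∀ t → 8 ℕ.* t ℕ.+ 8 ℕ.* t ≡ 8 ℕ.* (2 ℕ.* t)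
  double = ℕ-Solver.solve-∀

5+2n≤8*2ⁿ : ∀ n → 5 ℕ.+ 2 ℕ.* n ≤ 8 ℕ.* 2 ℕ.^ n
5+2n≤8*2ⁿ zero    = m≤m+n 5 3
5+2n≤8*2ⁿ (suc n) = begin
  5 ℕ.+ 2 ℕ.* suc n               ≡⟨ shift n ⟩
  (5 ℕ.+ 2 ℕ.* n) ℕ.+ 2           ≤⟨ +-mono-≤ (5+2n≤8*2ⁿ n) (≤-trans (m≤m+n 2 6) (m≤m*n 8 (2 ℕ.^ n))) ⟩
  8 ℕ.* 2 ℕ.^ n ℕ.+ 8 ℕ.* 2 ℕ.^ n ≡⟨ 8*2ⁿ+8*2ⁿ≡8*2¹⁺ⁿ n ⟩
  8 ℕ.* 2 ℕ.^ suc n               ∎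
  where
  open ≤-Reasoning
  instance _ = m^n≢0 2 n
  shift : ∀ n → 5 ℕ.+ 2 ℕ.* suc n ≡ (5 ℕ.+ 2 ℕ.* n) ℕ.+ 2
  shift = ℕ-Solver.solve-∀

[2+n]²≤8*2ⁿ : ∀ n → (2 ℕ.+ n) ℕ.* (2 ℕ.+ n) ≤ 8 ℕ.* 2 ℕ.^ n
[2+n]²≤8*2ⁿ zero    = m≤m+n 4 4
[2+n]²≤8*2ⁿ (suc n) = begin
  (3 ℕ.+ n) ℕ.* (3 ℕ.+ n)                       ≡⟨ expand n ⟩
  (2 ℕ.+ n) ℕ.* (2 ℕ.+ n) ℕ.+ (5 ℕ.+ 2 ℕ.* n)   ≤⟨ +-mono-≤ ([2+n]²≤8*2ⁿ n) (5+2n≤8*2ⁿ n) ⟩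
  8 ℕ.* 2 ℕ.^ n ℕ.+ 8 ℕ.* 2 ℕ.^ n               ≡⟨ 8*2ⁿ+8*2ⁿ≡8*2¹⁺ⁿ n ⟩
  8 ℕ.* 2 ℕ.^ suc n                             ∎
  where
  open ≤-Reasoning
  expand : ∀ n → (3 ℕ.+ n) ℕ.* (3 ℕ.+ n) ≡ (2 ℕ.+ n) ℕ.* (2 ℕ.+ n) ℕ.+ (5 ℕ.+ 2 ℕ.* n)
  expand = ℕ-Solver.solve-∀

2ⁿ≤X[2+n]⇒2ⁿ≤8X² : ∀ {n X} → 2 ℕ.^ n ≤ X ℕ.* (2 ℕ.+ n) → 2 ℕ.^ n ≤ 8 ℕ.* (X ℕ.* X)
2ⁿ≤X[2+n]⇒2ⁿ≤8X² {n} {X} 2ⁿ≤X[2+n] = *-cancelʳ-≤ (2 ℕ.^ n) (8 ℕ.* (X ℕ.* X)) (2 ℕ.^ n) (begin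
  2 ℕ.^ n ℕ.* 2 ℕ.^ n                         ≤⟨ *-mono-≤ 2ⁿ≤X[2+n] 2ⁿ≤X[2+n] ⟩
  X ℕ.* (2 ℕ.+ n) ℕ.* (X ℕ.* (2 ℕ.+ n))       ≡⟨ regroup X (2 ℕ.+ n) ⟩
  X ℕ.* X ℕ.* ((2 ℕ.+ n) ℕ.* (2 ℕ.+ n))       ≤⟨ *-monoʳ-≤ (X ℕ.* X) ([2+n]²≤8*2ⁿ n) ⟩
  X ℕ.* X ℕ.* (8 ℕ.* 2 ℕ.^ n)                 ≡⟨ reassoc (X ℕ.* X) (2 ℕ.^ n) ⟩
  8 ℕ.* (X ℕ.* X) ℕ.* 2 ℕ.^ n                 ∎)
  where
  open ≤-Reasoning
  instance _ = m^n≢0 2 n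
  regroup : ∀ X m → X ℕ.* m ℕ.* (X ℕ.* m) ≡ X ℕ.* X ℕ.* (m ℕ.* m)
  regroup = ℕ-Solver.solve-∀
  reassoc : ∀ s t → s ℕ.* (8 ℕ.* t) ≡ 8 ℕ.* s ℕ.* t
  reassoc = ℕ-Solver.solve-∀

expLt-of-4ⁿ : ∀ {n M} → 2 ℕ.^ (n ℕ.* 2) < M → ExpLt n M
expLt-of-4ⁿ {n} {M} 4ⁿ<M = 0 , subst (2 ℕ.^ (n ℕ.* 2) <_) (sym M*1≡M) 4ⁿ<M
  where
  M*1≡M : M ℕ.* 1 ℕ.^ (n ℕ.* 2) ≡ M
  M*1≡M = trans (cong (M ℕ.*_) (^-zeroˡ (n ℕ.* 2))) (*-identityʳ M)

ltThirtyNineYLogY-of-2ⁿ≤ : ∀ {n Y} j → 2 ≤ Y → 2 ℕ.^ n ≤ Y ℕ.^ j → j ℕ.* 2 < 39 ℕ.* Y →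
                           LtThirtyNineYLogY n Y
ltThirtyNineYLogY-of-2ⁿ≤ {n} {Y} j 2≤Y 2ⁿ≤Yʲ j*2<39Y = expLt-of-4ⁿ {n} (begin-strict
  2 ℕ.^ (n ℕ.* 2)  ≡⟨ ^-*-assoc 2 n 2 ⟨
  (2 ℕ.^ n) ℕ.^ 2  ≤⟨ ^-monoˡ-≤ 2 2ⁿ≤Yʲ ⟩
  (Y ℕ.^ j) ℕ.^ 2  ≡⟨ ^-*-assoc Y j 2 ⟩
  Y ℕ.^ (j ℕ.* 2)  <⟨ ^-monoʳ-< Y 2≤Y j*2<39Y ⟩
  Y ℕ.^ (39 ℕ.* Y) ∎)
  where open ≤-Reasoning

ltThirtyNineYLogY-of-≤1+Y : ∀ {n Y} → 2 ≤ Y → n ≤ suc Y → LtThirtyNineYLogY n Y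
ltThirtyNineYLogY-of-≤1+Y {n} {Y} 2≤Y n≤1+Y = ltThirtyNineYLogY-of-2ⁿ≤ {n} (suc Y) 2≤Y
  (≤-trans (^-monoʳ-≤ 2 n≤1+Y) (^-monoˡ-≤ (suc Y) 2≤Y))
  (begin
    3 ℕ.+ Y ℕ.* 2       ≤⟨ +-monoˡ-≤ (Y ℕ.* 2) (m≤m*n 3 Y) ⟩
    3 ℕ.* Y ℕ.+ Y ℕ.* 2 ≡⟨ collect Y ⟩
    5 ℕ.* Y             ≤⟨ *-monoˡ-≤ Y (m≤m+n 5 34) ⟩
    39 ℕ.* Y            ∎)
  where
  open ≤-Reasoning
  instance _ = ℕ.>-nonZero (<⇒≤ 2≤Y)
  collect : ∀ Y → 3 ℕ.* Y ℕ.+ Y ℕ.* 2 ≡ 5 ℕ.* Y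
  collect = ℕ-Solver.solve-∀

ltThirtyNineYLogY-of-2ⁿ≤Y⁷[2+n] : ∀ {n Y} → 2 ≤ Y → 2 ℕ.^ n ≤ Y ℕ.^ 7 ℕ.* (2 ℕ.+ n) →
                                  LtThirtyNineYLogY n Y
ltThirtyNineYLogY-of-2ⁿ≤Y⁷[2+n] {n} {Y} 2≤Y 2ⁿ≤Y⁷[2+n] = ltThirtyNineYLogY-of-2ⁿ≤ {n} 17 2≤Y
  (begin
    2 ℕ.^ n                       ≤⟨ 2ⁿ≤X[2+n]⇒2ⁿ≤8X² {n} {Y ℕ.^ 7} 2ⁿ≤Y⁷[2+n] ⟩
    8 ℕ.* (Y ℕ.^ 7 ℕ.* Y ℕ.^ 7)   ≤⟨ *-mono-≤ (^-monoˡ-≤ 3 2≤Y) (≤-reflexive (sym (^-distribˡ-+-* Y 7 7))) ⟩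
    Y ℕ.^ 3 ℕ.* Y ℕ.^ 14          ≡⟨ ^-distribˡ-+-* Y 3 14 ⟨
    Y ℕ.^ 17                      ∎)
  (≤-trans (m≤m+n 35 43) (*-monoʳ-≤ 39 2≤Y))
  where open ≤-Reasoning

-- Size of the coefficients

abs-^ : ∀ i n → ∣ i ^ n ∣ ≡ ∣ i ∣ ℕ.^ n
abs-^ i zero    = refl
abs-^ i (suc n) = trans (ℤP.abs-* i (i ^ n)) (cong (∣ i ∣ ℕ.*_) (abs-^ i n))

∣i∣≤∣i*j∣ : ∀ i {j} → j ≢ 0ℤ → ∣ i ∣ ≤ ∣ i * j ∣
∣i∣≤∣i*j∣ i {j} j≢0 = subst (∣ i ∣ ≤_) (sym (ℤP.abs-* i j))
  (m≤m*n ∣ i ∣ ∣ j ∣ {{ℕ.≢-nonZero (j≢0 ∘ ℤP.∣i∣≡0⇒i≡0)}})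

x*aⁿ+y*bⁿ≡0⇒∣x∣∣a∣ⁿ≡∣y∣∣b∣ⁿ : ∀ x y a b n → x * a ^ n + y * b ^ n ≡ 0ℤ →
                             ∣ x ∣ ℕ.* ∣ a ∣ ℕ.^ n ≡ ∣ y ∣ ℕ.* ∣ b ∣ ℕ.^ n
x*aⁿ+y*bⁿ≡0⇒∣x∣∣a∣ⁿ≡∣y∣∣b∣ⁿ x y a b n sum≡0 = begin
  ∣ x ∣ ℕ.* ∣ a ∣ ℕ.^ n ≡⟨ abs-*-^ x a ⟨
  ∣ x * a ^ n ∣         ≡⟨ cong ∣_∣ (inverseˡ-unique (x * a ^ n) (y * b ^ n) sum≡0) ⟩
  ∣ - (y * b ^ n) ∣     ≡⟨ ℤP.∣-i∣≡∣i∣ (y * b ^ n) ⟩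
  ∣ y * b ^ n ∣         ≡⟨ abs-*-^ y b ⟩
  ∣ y ∣ ℕ.* ∣ b ∣ ℕ.^ n ∎
  where
  open ≡-Reasoning
  abs-*-^ : ∀ z c → ∣ z * c ^ n ∣ ≡ ∣ z ∣ ℕ.* ∣ c ∣ ℕ.^ n
  abs-*-^ z c = trans (ℤP.abs-* z (c ^ n)) (cong (∣ z ∣ ℕ.*_) (abs-^ c n))

module Heights (Y : ℕ) (2≤Y : 2 ≤ Y) where

  record Bounded (i : ℕ) (z : ℤ) : Set where
    constructor bounded
    field bound : ∣ z ∣ ≤ Y ℕ.^ i

  instance
    Y≢0 : NonZero Y
    Y≢0 = ℕ.>-nonZero (<⇒≤ 2≤Y)

  bounded₁ : ∀ {z} → ∣ z ∣ ≤ Y → Bounded 1 z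
  bounded₁ z≤Y = bounded (≤-trans z≤Y (≤-reflexive (sym (*-identityʳ Y))))

  bounded-≤ : ∀ {i j z} → i ≤ j → Bounded i z → Bounded j z
  bounded-≤ i≤j (bounded z≤Yⁱ) = bounded (≤-trans z≤Yⁱ (^-monoʳ-≤ Y i≤j))

  bounded-neg : ∀ {i z} → Bounded i z → Bounded i (- z)
  bounded-neg {z = z} (bounded z≤Yⁱ) = bounded (subst (_≤ _) (sym (ℤP.∣-i∣≡∣i∣ z)) z≤Yⁱ)

  bounded-+ : ∀ {i x z} → Bounded i x → Bounded i z → Bounded (suc i) (x + z)
  bounded-+ {i} {x} {z} (bounded x≤Yⁱ) (bounded z≤Yⁱ) = bounded (begin
    ∣ x + z ∣               ≤⟨ ℤP.∣i+j∣≤∣i∣+∣j∣ x z ⟩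
    ∣ x ∣ ℕ.+ ∣ z ∣         ≤⟨ +-mono-≤ x≤Yⁱ z≤Yⁱ ⟩
    Y ℕ.^ i ℕ.+ Y ℕ.^ i     ≡⟨ cong (Y ℕ.^ i ℕ.+_) (+-identityʳ (Y ℕ.^ i)) ⟨
    2 ℕ.* Y ℕ.^ i           ≤⟨ *-monoˡ-≤ (Y ℕ.^ i) 2≤Y ⟩
    Y ℕ.^ suc i             ∎)
    where open ≤-Reasoning

  bounded-* : ∀ {i j x z} → Bounded i x → Bounded j z → Bounded (i ℕ.+ j) (x * z)
  bounded-* {i} {j} {x} {z} (bounded x≤Yⁱ) (bounded z≤Yʲ) = bounded (begin
    ∣ x * z ∣               ≡⟨ ℤP.abs-* x z ⟩
    ∣ x ∣ ℕ.* ∣ z ∣         ≤⟨ *-mono-≤ x≤Yⁱ z≤Yʲ ⟩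
    Y ℕ.^ i ℕ.* Y ℕ.^ j     ≡⟨ ^-distribˡ-+-* Y i j ⟨
    Y ℕ.^ (i ℕ.+ j)         ∎)
    where open ≤-Reasoning

  linear-bound : ∀ {i p q e} → Bounded i p → Bounded i q → Bounded i e →
                 ∀ n → ∣ p * ℤ.+ n + q ∣ ℕ.+ ∣ e ∣ ≤ Y ℕ.^ i ℕ.* (2 ℕ.+ n)
  linear-bound {i} {p} {q} {e} (bounded p≤Yⁱ) (bounded q≤Yⁱ) (bounded e≤Yⁱ) n = begin
    ∣ p * ℤ.+ n + q ∣ ℕ.+ ∣ e ∣             ≤⟨ +-monoˡ-≤ ∣ e ∣ (ℤP.∣i+j∣≤∣i∣+∣j∣ (p * ℤ.+ n) q) ⟩
    ∣ p * ℤ.+ n ∣ ℕ.+ ∣ q ∣ ℕ.+ ∣ e ∣       ≡⟨ cong (λ s → s ℕ.+ ∣ q ∣ ℕ.+ ∣ e ∣) (ℤP.abs-* p (ℤ.+ n)) ⟩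
    ∣ p ∣ ℕ.* n ℕ.+ ∣ q ∣ ℕ.+ ∣ e ∣         ≤⟨ +-mono-≤ (+-mono-≤ (*-monoˡ-≤ n p≤Yⁱ) q≤Yⁱ) e≤Yⁱ ⟩
    Y ℕ.^ i ℕ.* n ℕ.+ Y ℕ.^ i ℕ.+ Y ℕ.^ i   ≡⟨ collect (Y ℕ.^ i) n ⟩
    Y ℕ.^ i ℕ.* (2 ℕ.+ n)                   ∎
    where
    open ≤-Reasoning
    collect : ∀ X n → X ℕ.* n ℕ.+ X ℕ.+ X ≡ X ℕ.* (2 ℕ.+ n)
    collect = ℕ-Solver.solve-∀

module _ {Y : ℕ} (2≤Y : 2 ≤ Y) (α β : ℤ) (u : ℕ → ℤ) where
  open Heights Y 2≤Y
  open Coefficients α β u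

  coefficients-bounded : ∣ α ∣ ≤ Y → ∣ β ∣ ≤ Y → ∣ u 0 ∣ ≤ Y → ∣ u 1 ∣ ≤ Y → ∣ u 2 ∣ ≤ Y →
                         ∀ n → ∣ P * ℤ.+ n + Q ∣ ℕ.+ ∣ α * B ∣ ≤ Y ℕ.^ 7 ℕ.* (2 ℕ.+ n)
  coefficients-bounded ∣α∣≤Y ∣β∣≤Y ∣u₀∣≤Y ∣u₁∣≤Y ∣u₂∣≤Y =
    linear-bound hP hQ (bounded-≤ (n≤1+n 6) (bounded-* hα hB))
    where
    hα : Bounded 1 α
    hα = bounded₁ ∣α∣≤Y
    hβ : Bounded 1 β
    hβ = bounded₁ ∣β∣≤Y
    h₀ : Bounded 1 (u 0)
    h₀ = bounded₁ ∣u₀∣≤Y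
    h₁ : Bounded 1 (u 1)
    h₁ = bounded₁ ∣u₁∣≤Y
    h₂ : Bounded 1 (u 2)
    h₂ = bounded₁ ∣u₂∣≤Y

    second-difference : ∀ {γ δ} → Bounded 1 γ → Bounded 1 δ →
                        Bounded 5 (u 2 - (γ + δ) * u 1 + γ * δ * u 0)
    second-difference hγ hδ =
      bounded-+ (bounded-+ (bounded-≤ (s≤s z≤n) h₂)
                           (bounded-neg (bounded-* (bounded-+ hγ hδ) h₁)))
                (bounded-≤ (n≤1+n 3) (bounded-* (bounded-* hγ hδ) h₀))

    hd : Bounded 2 d
    hd = bounded-+ hα (bounded-neg hβ)

    hB : Bounded 5 B
    hB = second-difference hα hα

    hP : Bounded 7 P
    hP = bounded-* hd (second-difference hα hβ)

    hQ : Bounded 7 Q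
    hQ = bounded-* hα (bounded-+ (bounded-* (bounded-* hd hd) h₀) (bounded-neg hB))

module _ (α β : ℤ) (u : ℕ → ℤ) where

  height : ℕ
  height = ∣ α + α + β ∣ ⊔ ∣ - (α * α + α * β + α * β) ∣ ⊔ ∣ α * α * β ∣ ⊔ ∣ u 0 ∣ ⊔ ∣ u 1 ∣ ⊔ ∣ u 2 ∣

  private
    h₂ h₃ h₄ h₅ : ℕ
    h₂ = ∣ α + α + β ∣ ⊔ ∣ - (α * α + α * β + α * β) ∣
    h₃ = h₂ ⊔ ∣ α * α * β ∣
    h₄ = h₃ ⊔ ∣ u 0 ∣
    h₅ = h₄ ⊔ ∣ u 1 ∣

  ∣u₂∣≤height : ∣ u 2 ∣ ≤ height
  ∣u₂∣≤height = m≤n⊔m h₅ ∣ u 2 ∣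

  ∣u₁∣≤height : ∣ u 1 ∣ ≤ height
  ∣u₁∣≤height = ≤-trans (m≤n⊔m h₄ ∣ u 1 ∣) (m≤m⊔n h₅ ∣ u 2 ∣)

  ∣u₀∣≤height : ∣ u 0 ∣ ≤ height
  ∣u₀∣≤height = ≤-trans (m≤n⊔m h₃ ∣ u 0 ∣) (≤-trans (m≤m⊔n h₄ ∣ u 1 ∣) (m≤m⊔n h₅ ∣ u 2 ∣))

  ∣α*α*β∣≤height : ∣ α * α * β ∣ ≤ height
  ∣α*α*β∣≤height = ≤-trans (m≤n⊔m h₂ ∣ α * α * β ∣) (≤-trans (m≤m⊔n h₃ ∣ u 0 ∣) (≤-trans (m≤m⊔n h₄ ∣ u 1 ∣) (m≤m⊔n h₅ ∣ u 2 ∣)))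

  module _ (α≢0 : α ≢ 0ℤ) (β≢0 : β ≢ 0ℤ) where

    ∣α∣≤height : ∣ α ∣ ≤ height
    ∣α∣≤height = ≤-trans (∣i∣≤∣i*j∣ α α≢0) (≤-trans (∣i∣≤∣i*j∣ (α * α) β≢0) ∣α*α*β∣≤height)

    ∣β∣≤height : ∣ β ∣ ≤ height
    ∣β∣≤height = ≤-trans (∣i∣≤∣i*j∣ β α*α≢0)
                         (≤-trans (≤-reflexive (cong ∣_∣ (ℤP.*-comm β (α * α)))) ∣α*α*β∣≤height)
      where
      α*α≢0 : α * α ≢ 0ℤ
      α*α≢0 = [ α≢0 , α≢0 ]′ ∘ ℤP.i*j≡0⇒i≡0∨j≡0 α

    2≤height : ∣ α ∣ ≢ ∣ β ∣ → 2 ≤ height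
    2≤height ∣α∣≢∣β∣ = [ (λ 2≤∣α∣ → ≤-trans 2≤∣α∣ ∣α∣≤height) , (λ 2≤∣β∣ → ≤-trans 2≤∣β∣ ∣β∣≤height) ]′
      (2≤m⊎2≤n (α≢0 ∘ ℤP.∣i∣≡0⇒i≡0) (β≢0 ∘ ℤP.∣i∣≡0⇒i≡0) ∣α∣≢∣β∣)

lemma3p2 : (α β r₁ r₂ r₃ : ℤ) (u : ℕ → ℤ) →
    α ≢ ℤ.0ℤ → β ≢ ℤ.0ℤ → Coprime ∣ α ∣ ∣ β ∣ → ∣ α ∣ ≢ ∣ β ∣ →
    (∀ n → u (ℕ.suc (ℕ.suc (ℕ.suc n))) ≡ r₁ * u (ℕ.suc (ℕ.suc n)) + r₂ * u (ℕ.suc n) + r₃ * u n) →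
    r₁ ≡ α + α + β →
    r₂ ≡ - (α * α + α * β + α * β) →
    r₃ ≡ α * α * β →
    (a b c : ℚ) → a ≢ ℚ.0ℚ →
    (∀ n → toℚ (u n) ≡ (a ℚ.* toℚ (ℤ.+ n) ℚ.+ c) ℚ.* toℚ (α ^ n) ℚ.+ b ℚ.* toℚ (β ^ n)) →
    (n : ℕ) → u n ≡ ℤ.0ℤ →
    LtThirtyNineYLogY n (∣ r₁ ∣ ⊔ ∣ r₂ ∣ ⊔ ∣ r₃ ∣ ⊔ ∣ u 0 ∣ ⊔ ∣ u 1 ∣ ⊔ ∣ u 2 ∣)
lemma3p2 α β _ _ _ u α≢0 β≢0 ∣α∣⊥∣β∣ ∣α∣≢∣β∣ rec refl refl refl a b c a≢0 closed n uₙ≡0 =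
  [ both-vanish , (λ 2ⁿ≤ → ltThirtyNineYLogY-of-2ⁿ≤Y⁷[2+n] 2≤Y (≤-trans 2ⁿ≤ coefficients≤Y⁷[2+n])) ]′
    (balance-bound n ∣α∣≢0 ∣β∣≢0 ∣α∣⊥∣β∣ (2≤m⊎2≤n ∣α∣≢0 ∣β∣≢0 ∣α∣≢∣β∣) balance)
  where
  open Coefficients α β u

  Y : ℕ
  Y = height α β u

  ∣α∣≢0 : ∣ α ∣ ≢ 0
  ∣α∣≢0 = α≢0 ∘ ℤP.∣i∣≡0⇒i≡0

  ∣β∣≢0 : ∣ β ∣ ≢ 0
  ∣β∣≢0 = β≢0 ∘ ℤP.∣i∣≡0⇒i≡0

  2≤Y : 2 ≤ Y
  2≤Y = 2≤height α β u α≢0 β≢0 ∣α∣≢∣β∣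

  balance : ∣ P * ℤ.+ n + Q ∣ ℕ.* ∣ α ∣ ℕ.^ n ≡ ∣ α * B ∣ ℕ.* ∣ β ∣ ℕ.^ n
  balance = x*aⁿ+y*bⁿ≡0⇒∣x∣∣a∣ⁿ≡∣y∣∣b∣ⁿ (P * ℤ.+ n + Q) (α * B) α β n (begin
    closedForm α β P Q (α * B) n ≡⟨ scaled-closedForm (recurrence rec) n ⟨
    α * d * d * u n              ≡⟨ cong (α * d * d *_) uₙ≡0 ⟩
    α * d * d * 0ℤ               ≡⟨ ℤP.*-zeroʳ (α * d * d) ⟩
    0ℤ                           ∎)
    where open ≡-Reasoning

  coefficients≤Y⁷[2+n] : ∣ P * ℤ.+ n + Q ∣ ℕ.+ ∣ α * B ∣ ≤ Y ℕ.^ 7 ℕ.* (2 ℕ.+ n)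
  coefficients≤Y⁷[2+n] = coefficients-bounded 2≤Y α β u
    (∣α∣≤height α β u α≢0 β≢0) (∣β∣≤height α β u α≢0 β≢0)
    (∣u₀∣≤height α β u) (∣u₁∣≤height α β u) (∣u₂∣≤height α β u) n

  both-vanish : ∣ P * ℤ.+ n + Q ∣ ≡ 0 × ∣ α * B ∣ ≡ 0 → LtThirtyNineYLogY n Y
  both-vanish (∣N∣≡0 , ∣αB∣≡0) = ltThirtyNineYLogY-of-≤1+Y 2≤Y (≤-trans
    (P*n+Q≡0⇒n≤1+∣u₁∣ d≢0 A≢0 B≡0 n (ℤP.∣i∣≡0⇒i≡0 ∣N∣≡0)) (s≤s (∣u₁∣≤height α β u)))
    where
    d≢0 : d ≢ 0ℤ
    d≢0 = ∣α∣≢∣β∣ ∘ cong ∣_∣ ∘ ℤP.i-j≡0⇒i≡j α β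

    A≢0 : A ≢ 0ℤ
    A≢0 = a≢0⇒A≢0 a b c closed a≢0 ([ d≢0 , α≢0 ]′ ∘ ℤP.i*j≡0⇒i≡0∨j≡0 d)

    B≡0 : B ≡ 0ℤ
    B≡0 = [ ⊥-elim ∘ α≢0 , id ]′ (ℤP.i*j≡0⇒i≡0∨j≡0 α (ℤP.∣i∣≡0⇒i≡0 ∣αB∣≡0))
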